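{- For all integers $0 \leq j \leq k$, $$\binom{k}{j} B_{k-j} = (j+1) \sum_{i=j}^{k} \frac{1}{i+1}\, S_1(i+1,j+1)\, S_2(k,i).$$
   Context: $B_n = B_n(0)$ denotes the Bernoulli numbers, where the Bernoulli polynomials $B_n(x)$ are defined by $\frac{t e^{xt}}{e^t-1} = \sum_{n=0}^{\infty} B_n(x) \frac{t^n}{n!}$ for $|t|<2\pi$ (so $B_1 = -\tfrac12$). $S_1(n,j)$ denotes the signed Stirling numbers of the first kind, defined by $x(x-1)\cdots(x-n+1) = \sum_{j=0}^{n} S_1(n,j) x^j$. $S_2(k,i)$ denotes the Stirling numbers of the second kind (the number of partitions of a $k$-element set into $i$ nonempty blocks, with $S_2(0,0)=1$). -}

module Defs where

open import Data.Nat as ℕ using (ℕ; zero; suc)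
open import Data.Nat.Combinatorics using (_C_)
open import Data.Integer as ℤ using (ℤ; +_)
open import Data.Rational as ℚ using (ℚ; 0ℚ; 1ℚ; _/_)
open import Data.List using (List; []; _∷_; _++_; length; upTo; map; foldr; zip)

ΣQ : ℕ → ℕ → (ℕ → ℚ) → ℚ
ΣQ a b f = foldr ℚ._+_ 0ℚ (map (λ t → f (a ℕ.+ t)) (upTo (suc b ℕ.∸ a)))

-- Bernoulli numbers B_n = B_n(0) with B_1 = -1/2, characterised by the
-- recurrence coming from t/(e^t - 1) = Σ B_n t^n/n! :
--   B_0 = 1,   Σ_{m=0}^{n} C(n+1,m) B_m = 0  for n ≥ 1.
-- bernList n = [B_0, …, B_{n-1}]
private
  weighted : ℕ → ℕ → List ℚ → ℚ
  weighted n m [] = 0ℚ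
  weighted n m (b ∷ bs) = ℚ._+_ (ℚ._*_ ((+ ((suc n) C m)) / 1) b) (weighted n (suc m) bs)

  nextB : ℕ → List ℚ → ℚ
  nextB zero bs = 1ℚ
  nextB (suc k) bs = ℚ.-_ (ℚ._*_ ((+ 1) / (suc (suc k))) (weighted (suc k) 0 bs))

bernList : ℕ → List ℚ
bernList zero = []
bernList (suc n) = bernList n ++ (nextB n (bernList n) ∷ [])

private
  lastOr : List ℚ → ℚ
  lastOr [] = 0ℚ
  lastOr (x ∷ []) = x
  lastOr (x ∷ y ∷ xs) = lastOr (y ∷ xs)

bernoulli : ℕ → ℚ
bernoulli n = lastOr (bernList (suc n))

-- Signed Stirling numbers of the first kind:
--   x(x-1)…(x-n+1) = Σ_j S₁(n,j) x^j,  so S₁(n+1,j+1) = S₁(n,j) - n S₁(n,j+1).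
S₁ : ℕ → ℕ → ℤ
S₁ zero zero = + 1
S₁ zero (suc j) = + 0
S₁ (suc n) zero = + 0
S₁ (suc n) (suc j) = S₁ n j ℤ.- (+ n) ℤ.* S₁ n (suc j)

S₂ : ℕ → ℕ → ℕ
S₂ zero zero = 1
S₂ zero (suc i) = 0
S₂ (suc n) zero = 0
S₂ (suc n) (suc i) = S₂ n i ℕ.+ suc i ℕ.* S₂ n (suc i)

{-# OPTIONS --safe #-}
-- With stirlingCoeff k m = ∑_{i ≤ k} s₁(i+1,m) S₂(k,i)/(i+1) and bernoulliCoeff k m = C(k+1,m) B_{k+1−m}/(k+1),
-- the right-hand side is (j+1) · stirlingCoeff k (j+1) and, since C(k+1,j+1)(j+1) = (k+1) C(k,j), the left-hand
-- side is (j+1) · bernoulliCoeff k (j+1). Both sequences solve the system ∑_{m ≤ k+1} d m C(m,p) = d p + δ_{kp}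
-- (p ≤ k), which is triangular: row p determines d (p+1) from d (p+2), …, d (k+1). So they agree on 1, …, k+1.
-- For stirlingCoeff, exchanging the sums and expanding (x+1)(x)⋯(x−i+1) = x(x−1)⋯(x−i) + (i+1) x(x−1)⋯(x−i+1)
-- reduces the system to Stirling inversion ∑_i S₂(k,i) s₁(i,p) = δ_{kp}. For bernoulliCoeff, the identity
-- C(k+1,m) C(m,p) = C(k+1,p) C(k+1−p, m−p) reduces it to the recurrence ∑_{r ≤ n} C(n+1,r) B_r = δ_{n0}
-- that defines the Bernoulli numbers.
module Submission where

open import Defs
open import Data.Nat as ℕ using (ℕ; zero; suc; _≤_; _<_; _∸_; s≤s; _!)
import Data.Nat.Properties as ℕ
open import Data.Nat.Combinatorics
open import Data.Nat.DivMod using (m/n*n≡m)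
import Data.Nat.Tactic.RingSolver as ℕ-Solver
open import Data.Integer as ℤ using (ℤ; +_)
import Data.Integer.Properties as ℤ
open import Data.Rational as ℚ using (ℚ; 0ℚ; 1ℚ; _/_)
import Data.Rational.Properties as ℚ
import Data.Rational.Unnormalised as ℚᵘ
import Data.Rational.Unnormalised.Properties as ℚᵘ
open import Data.List using (List; []; _∷_; _∷ʳ_; length; foldr; map; applyUpTo)
open import Data.List.Properties using (∷ʳ-injectiveʳ; length-++)
open import Data.Empty using (⊥-elim)
open import Function using (_∘_)
open import Level using (0ℓ)
open import Relation.Binary.PropositionalEquality
open import Relation.Nullary.Decidable using (dec⇒maybe)
open import Tactic.RingSolver using (solve-∀)
open import Tactic.RingSolver.Core.AlmostCommutativeRing using (AlmostCommutativeRing; fromCommutativeRing)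

module _ where
  open import Data.Nat using (_+_; _*_)

  [1+n]Cn≡1+n : ∀ n → suc n C n ≡ suc n
  [1+n]Cn≡1+n n = begin
    suc n C n              ≡⟨ nCk≡nC[n∸k] (ℕ.n≤1+n n) ⟩
    suc n C (suc n ∸ n)    ≡⟨ cong (suc n C_) (ℕ.m+n∸n≡m 1 n) ⟩
    suc n C 1              ≡⟨ nC1≡n (suc n) ⟩
    suc n                  ∎
    where open ≡-Reasoning

  [m+n]Cm*m!*n!≡[m+n]! : ∀ m n → ((m + n) C m) * (m ! * n !) ≡ (m + n) !
  [m+n]Cm*m!*n!≡[m+n]! m n = begin
    ((m + n) C m) * (m ! * n !)
      ≡⟨ cong (λ k → ((m + n) C m) * (m ! * k !)) (ℕ.m+n∸m≡n m n) ⟨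
    ((m + n) C m) * (m ! * (m + n ∸ m) !)
      ≡⟨ cong (_* (m ! * (m + n ∸ m) !)) (nCk≡n!/k![n-k]! (ℕ.m≤m+n m n)) ⟩
    (m + n) ! ℕ./ (m ! * (m + n ∸ m) !) * (m ! * (m + n ∸ m) !)
      ≡⟨ m/n*n≡m (k![n∸k]!∣n! (ℕ.m≤m+n m n)) ⟩
    (m + n) ! ∎
    where
    open ≡-Reasoning
    instance _ = ℕ._!*_!≢0 m (m + n ∸ m)

  C-trinomial-revision : ∀ p q r → ((p + q + r) C (p + q)) * ((p + q) C p) ≡ ((p + q + r) C p) * ((q + r) C q)
  C-trinomial-revision p q r = ℕ.*-cancelʳ-≡ _ _ (p ! * q ! * r !) {{p!q!r!≢0}} (trans lhs≡A! (sym rhs≡A!))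
    where
    open ≡-Reasoning
    p!q!r!≢0 = ℕ.m*n≢0 (p ! * q !) (r !) {{ℕ._!*_!≢0 p q}} {{ℕ._!≢0 r}}
    regroupˡ : ∀ a b x y z → a * b * (x * y * z) ≡ a * (b * (x * y) * z)
    regroupˡ = ℕ-Solver.solve-∀
    regroupʳ : ∀ a b x y z → a * b * (x * y * z) ≡ a * (x * (b * (y * z)))
    regroupʳ = ℕ-Solver.solve-∀
    lhs≡A! : ((p + q + r) C (p + q)) * ((p + q) C p) * (p ! * q ! * r !) ≡ (p + q + r) !
    lhs≡A! = begin
      ((p + q + r) C (p + q)) * ((p + q) C p) * (p ! * q ! * r !)
        ≡⟨ regroupˡ ((p + q + r) C (p + q)) ((p + q) C p) (p !) (q !) (r !) ⟩
      ((p + q + r) C (p + q)) * (((p + q) C p) * (p ! * q !) * r !)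
        ≡⟨ cong (λ x → ((p + q + r) C (p + q)) * (x * r !)) ([m+n]Cm*m!*n!≡[m+n]! p q) ⟩
      ((p + q + r) C (p + q)) * ((p + q) ! * r !)
        ≡⟨ [m+n]Cm*m!*n!≡[m+n]! (p + q) r ⟩
      (p + q + r) ! ∎
    rhs≡A! : ((p + q + r) C p) * ((q + r) C q) * (p ! * q ! * r !) ≡ (p + q + r) !
    rhs≡A! = begin
      ((p + q + r) C p) * ((q + r) C q) * (p ! * q ! * r !)
        ≡⟨ regroupʳ ((p + q + r) C p) ((q + r) C q) (p !) (q !) (r !) ⟩
      ((p + q + r) C p) * (p ! * (((q + r) C q) * (q ! * r !)))
        ≡⟨ cong (λ x → ((p + q + r) C p) * (p ! * x)) ([m+n]Cm*m!*n!≡[m+n]! q r) ⟩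
      ((p + q + r) C p) * (p ! * (q + r) !)
        ≡⟨ cong (λ k → (k C p) * (p ! * (q + r) !)) (ℕ.+-assoc p q r) ⟩
      ((p + (q + r)) C p) * (p ! * (q + r) !)
        ≡⟨ [m+n]Cm*m!*n!≡[m+n]! p (q + r) ⟩
      (p + (q + r)) !
        ≡⟨ cong _! (ℕ.+-assoc p q r) ⟨
      (p + q + r) ! ∎

  C-absorption : ∀ m n → (suc (m + n) C suc m) * suc m ≡ suc (m + n) * ((m + n) C m)
  C-absorption m n = ℕ.*-cancelʳ-≡ _ _ (m ! * n !) {{ℕ._!*_!≢0 m n}} (trans lhs≡ (sym rhs≡))
    where
    open ≡-Reasoning
    regroup : ∀ c m x y → c * suc m * (x * y) ≡ c * (suc m * x * y)
    regroup = ℕ-Solver.solve-∀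
    lhs≡ : (suc (m + n) C suc m) * suc m * (m ! * n !) ≡ suc (m + n) * (m + n) !
    lhs≡ = begin
      (suc (m + n) C suc m) * suc m * (m ! * n !) ≡⟨ regroup (suc (m + n) C suc m) m (m !) (n !) ⟩
      (suc (m + n) C suc m) * (suc m ! * n !)     ≡⟨ [m+n]Cm*m!*n!≡[m+n]! (suc m) n ⟩
      suc (m + n) * (m + n) !                     ∎
    rhs≡ : suc (m + n) * ((m + n) C m) * (m ! * n !) ≡ suc (m + n) * (m + n) !
    rhs≡ = trans (ℕ.*-assoc (suc (m + n)) ((m + n) C m) (m ! * n !)) (cong (suc (m + n) *_) ([m+n]Cm*m!*n!≡[m+n]! m n))

open import Data.Rational using (_+_; _*_; _-_; -_)

ℚ-ring : AlmostCommutativeRing 0ℓ 0ℓ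
ℚ-ring = fromCommutativeRing ℚ.+-*-commutativeRing (λ q → dec⇒maybe (0ℚ ℚ.≟ q))

ℤ→ℚ : ℤ → ℚ
ℤ→ℚ z = z / 1

ℕ→ℚ : ℕ → ℚ
ℕ→ℚ n = ℤ→ℚ (+ n)

1/suc : ℕ → ℚ
1/suc n = + 1 / suc n

private
  toℚᵘ-ℤ→ℚ : ∀ z → ℚ.toℚᵘ (ℤ→ℚ z) ℚᵘ.≃ ℚᵘ.mkℚᵘ z 0
  toℚᵘ-ℤ→ℚ z = ℚ.toℚᵘ-fromℚᵘ (ℚᵘ.mkℚᵘ z 0)

ℤ→ℚ-+ : ∀ a b → ℤ→ℚ (a ℤ.+ b) ≡ ℤ→ℚ a + ℤ→ℚ b
ℤ→ℚ-+ a b = ℚ.toℚᵘ-injective (begin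
  ℚ.toℚᵘ (ℤ→ℚ (a ℤ.+ b))               ≈⟨ toℚᵘ-ℤ→ℚ (a ℤ.+ b) ⟩
  ℚᵘ.mkℚᵘ (a ℤ.+ b) 0                  ≈⟨ ℚᵘ.*≡* (cong (ℤ._* + 1) (cong₂ ℤ._+_ (sym (ℤ.*-identityʳ a))
                                                                         (sym (ℤ.*-identityʳ b)))) ⟩
  ℚᵘ.mkℚᵘ a 0 ℚᵘ.+ ℚᵘ.mkℚᵘ b 0         ≈⟨ ℚᵘ.+-cong (toℚᵘ-ℤ→ℚ a) (toℚᵘ-ℤ→ℚ b) ⟨
  ℚ.toℚᵘ (ℤ→ℚ a) ℚᵘ.+ ℚ.toℚᵘ (ℤ→ℚ b)  ≈⟨ ℚ.toℚᵘ-homo-+ (ℤ→ℚ a) (ℤ→ℚ b) ⟨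
  ℚ.toℚᵘ (ℤ→ℚ a + ℤ→ℚ b)               ∎)
  where open ℚᵘ.≃-Reasoning

ℤ→ℚ-* : ∀ a b → ℤ→ℚ (a ℤ.* b) ≡ ℤ→ℚ a * ℤ→ℚ b
ℤ→ℚ-* a b = ℚ.toℚᵘ-injective (begin
  ℚ.toℚᵘ (ℤ→ℚ (a ℤ.* b))               ≈⟨ toℚᵘ-ℤ→ℚ (a ℤ.* b) ⟩
  ℚᵘ.mkℚᵘ a 0 ℚᵘ.* ℚᵘ.mkℚᵘ b 0         ≈⟨ ℚᵘ.*-cong (toℚᵘ-ℤ→ℚ a) (toℚᵘ-ℤ→ℚ b) ⟨
  ℚ.toℚᵘ (ℤ→ℚ a) ℚᵘ.* ℚ.toℚᵘ (ℤ→ℚ b)  ≈⟨ ℚ.toℚᵘ-homo-* (ℤ→ℚ a) (ℤ→ℚ b) ⟨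
  ℚ.toℚᵘ (ℤ→ℚ a * ℤ→ℚ b)               ∎)
  where open ℚᵘ.≃-Reasoning

ℤ→ℚ-neg : ∀ a → ℤ→ℚ (ℤ.- a) ≡ - ℤ→ℚ a
ℤ→ℚ-neg a = ℚ.toℚᵘ-injective (begin
  ℚ.toℚᵘ (ℤ→ℚ (ℤ.- a))    ≈⟨ toℚᵘ-ℤ→ℚ (ℤ.- a) ⟩
  ℚᵘ.- ℚᵘ.mkℚᵘ a 0        ≈⟨ ℚᵘ.-‿cong (toℚᵘ-ℤ→ℚ a) ⟨
  ℚᵘ.- ℚ.toℚᵘ (ℤ→ℚ a)     ≈⟨ ℚ.toℚᵘ-homo‿- (ℤ→ℚ a) ⟨
  ℚ.toℚᵘ (- ℤ→ℚ a)        ∎)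
  where open ℚᵘ.≃-Reasoning

ℤ→ℚ-- : ∀ a b → ℤ→ℚ (a ℤ.- b) ≡ ℤ→ℚ a - ℤ→ℚ b
ℤ→ℚ-- a b = trans (ℤ→ℚ-+ a (ℤ.- b)) (cong (λ x → ℤ→ℚ a + x) (ℤ→ℚ-neg b))

ℕ→ℚ-+ : ∀ m n → ℕ→ℚ (m ℕ.+ n) ≡ ℕ→ℚ m + ℕ→ℚ n
ℕ→ℚ-+ m n = ℤ→ℚ-+ (+ m) (+ n)

ℕ→ℚ-* : ∀ m n → ℕ→ℚ (m ℕ.* n) ≡ ℕ→ℚ m * ℕ→ℚ n
ℕ→ℚ-* m n = trans (cong ℤ→ℚ (ℤ.pos-* m n)) (ℤ→ℚ-* (+ m) (+ n))

ℕ→ℚ-suc : ∀ n → ℕ→ℚ (suc n) ≡ 1ℚ + ℕ→ℚ n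
ℕ→ℚ-suc = ℕ→ℚ-+ 1

ℕ→ℚ-suc*1/suc : ∀ n → ℕ→ℚ (suc n) * 1/suc n ≡ 1ℚ
ℕ→ℚ-suc*1/suc n = ℚ.toℚᵘ-injective (begin
  ℚ.toℚᵘ (ℕ→ℚ (suc n) * 1/suc n)               ≈⟨ ℚ.toℚᵘ-homo-* (ℕ→ℚ (suc n)) (1/suc n) ⟩
  ℚ.toℚᵘ (ℕ→ℚ (suc n)) ℚᵘ.* ℚ.toℚᵘ (1/suc n)  ≈⟨ ℚᵘ.*-cong (toℚᵘ-ℤ→ℚ (+ suc n))
                                                            (ℚ.toℚᵘ-fromℚᵘ (ℚᵘ.mkℚᵘ (+ 1) n)) ⟩
  ℚᵘ.mkℚᵘ (+ suc n) 0 ℚᵘ.* ℚᵘ.mkℚᵘ (+ 1) n    ≈⟨ ℚᵘ.*≡* (cong +_ (ℕ-identity n)) ⟩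
  ℚᵘ.1ℚᵘ                                        ∎)
  where
  open ℚᵘ.≃-Reasoning
  ℕ-identity : ∀ n → suc n ℕ.* 1 ℕ.* 1 ≡ 1 ℕ.* (1 ℕ.* suc n)
  ℕ-identity = ℕ-Solver.solve-∀

∑ : ℕ → (ℕ → ℚ) → ℚ
∑ zero    f = 0ℚ
∑ (suc n) f = ∑ n f + f n

infix 6.5 ∑
syntax ∑ n (λ i → e) = ∑[ i < n ] e

∑-cong : ∀ n {f g} → (∀ i → i < n → f i ≡ g i) → ∑ n f ≡ ∑ n g
∑-cong zero    f≡g = refl
∑-cong (suc n) f≡g = cong₂ _+_ (∑-cong n (λ i i<n → f≡g i (ℕ.m≤n⇒m≤1+n i<n))) (f≡g n ℕ.≤-refl)

∑-zero : ∀ n {f} → (∀ i → i < n → f i ≡ 0ℚ) → ∑ n f ≡ 0ℚ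
∑-zero zero    f≡0 = refl
∑-zero (suc n) f≡0 = cong₂ _+_ (∑-zero n (λ i i<n → f≡0 i (ℕ.m≤n⇒m≤1+n i<n))) (f≡0 n ℕ.≤-refl)

∑-head : ∀ n f → ∑ (suc n) f ≡ f 0 + ∑[ i < n ] f (suc i)
∑-head zero    f = trans (ℚ.+-identityˡ (f 0)) (sym (ℚ.+-identityʳ (f 0)))
∑-head (suc n) f = trans (cong (_+ f (suc n)) (∑-head n f)) (ℚ.+-assoc (f 0) _ _)

∑-rotate : ∀ n f → f 0 ≡ 0ℚ → f n ≡ 0ℚ → ∑[ i < n ] f (suc i) ≡ ∑ n f
∑-rotate n f f0≡0 fn≡0 = begin
  ∑[ i < n ] f (suc i)              ≡⟨ ℚ.+-identityˡ _ ⟨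
  0ℚ + ∑[ i < n ] f (suc i)         ≡⟨ cong (_+ ∑[ i < n ] f (suc i)) f0≡0 ⟨
  f 0 + ∑[ i < n ] f (suc i)        ≡⟨ ∑-head n f ⟨
  ∑ n f + f n                       ≡⟨ cong (_+_ (∑ n f)) fn≡0 ⟩
  ∑ n f + 0ℚ                        ≡⟨ ℚ.+-identityʳ (∑ n f) ⟩
  ∑ n f                             ∎
  where open ≡-Reasoning

∑-split : ∀ m n f → ∑ (m ℕ.+ n) f ≡ ∑ m f + ∑[ i < n ] f (m ℕ.+ i)
∑-split m zero    f = trans (cong (λ k → ∑ k f) (ℕ.+-identityʳ m)) (sym (ℚ.+-identityʳ (∑ m f)))
∑-split m (suc n) f = begin
  ∑ (m ℕ.+ suc n) f                                      ≡⟨ cong (λ k → ∑ k f) (ℕ.+-suc m n) ⟩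
  ∑ (m ℕ.+ n) f + f (m ℕ.+ n)                            ≡⟨ cong (_+ f (m ℕ.+ n)) (∑-split m n f) ⟩
  ∑ m f + ∑[ i < n ] f (m ℕ.+ i) + f (m ℕ.+ n)           ≡⟨ ℚ.+-assoc (∑ m f) _ _ ⟩
  ∑ m f + ∑[ i < suc n ] f (m ℕ.+ i)                     ∎
  where open ≡-Reasoning

∑-head-zero : ∀ m n f → (∀ i → i < m → f i ≡ 0ℚ) → ∑ (m ℕ.+ n) f ≡ ∑[ i < n ] f (m ℕ.+ i)
∑-head-zero m n f head≡0 = begin
  ∑ (m ℕ.+ n) f                         ≡⟨ ∑-split m n f ⟩
  ∑ m f + ∑[ i < n ] f (m ℕ.+ i)        ≡⟨ cong (_+ ∑[ i < n ] f (m ℕ.+ i)) (∑-zero m head≡0) ⟩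
  0ℚ + ∑[ i < n ] f (m ℕ.+ i)           ≡⟨ ℚ.+-identityˡ _ ⟩
  ∑[ i < n ] f (m ℕ.+ i)                ∎
  where open ≡-Reasoning

∑-tail-zero : ∀ {m n} f → m ≤ n → (∀ i → m ≤ i → i < n → f i ≡ 0ℚ) → ∑ n f ≡ ∑ m f
∑-tail-zero {m} {n} f m≤n tail≡0 = begin
  ∑ n f                                 ≡⟨ cong (λ k → ∑ k f) (ℕ.m+[n∸m]≡n m≤n) ⟨
  ∑ (m ℕ.+ (n ∸ m)) f                   ≡⟨ ∑-split m (n ∸ m) f ⟩
  ∑ m f + ∑[ i < n ∸ m ] f (m ℕ.+ i)    ≡⟨ cong (_+_ (∑ m f)) (∑-zero (n ∸ m) tail-term≡0) ⟩
  ∑ m f + 0ℚ                            ≡⟨ ℚ.+-identityʳ (∑ m f) ⟩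
  ∑ m f                                 ∎
  where
  open ≡-Reasoning
  tail-term≡0 : ∀ i → i < n ∸ m → f (m ℕ.+ i) ≡ 0ℚ
  tail-term≡0 i i<n∸m =
    tail≡0 (m ℕ.+ i) (ℕ.m≤m+n m i) (subst (m ℕ.+ i <_) (ℕ.m+[n∸m]≡n m≤n) (ℕ.+-monoʳ-< m i<n∸m))

∑-distrib-+ : ∀ n f g → ∑[ i < n ] (f i + g i) ≡ ∑ n f + ∑ n g
∑-distrib-+ zero    f g = refl
∑-distrib-+ (suc n) f g =
  trans (cong (_+ (f n + g n)) (∑-distrib-+ n f g)) (+-interchange (∑ n f) (∑ n g) (f n) (g n))
  where
  +-interchange : ∀ a b c d → (a + b) + (c + d) ≡ (a + c) + (b + d)
  +-interchange = solve-∀ ℚ-ring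

∑-distrib-- : ∀ n f g → ∑[ i < n ] (f i - g i) ≡ ∑ n f - ∑ n g
∑-distrib-- zero    f g = refl
∑-distrib-- (suc n) f g =
  trans (cong (_+ (f n - g n)) (∑-distrib-- n f g)) (+-minus-interchange (∑ n f) (∑ n g) (f n) (g n))
  where
  +-minus-interchange : ∀ a b c d → (a - b) + (c - d) ≡ (a + c) - (b + d)
  +-minus-interchange = solve-∀ ℚ-ring

*-distribˡ-∑ : ∀ n c f → c * ∑ n f ≡ ∑[ i < n ] (c * f i)
*-distribˡ-∑ zero    c f = ℚ.*-zeroʳ c
*-distribˡ-∑ (suc n) c f = trans (ℚ.*-distribˡ-+ c (∑ n f) (f n)) (cong (_+ c * f n) (*-distribˡ-∑ n c f))

*-distribʳ-∑ : ∀ n f c → ∑ n f * c ≡ ∑[ i < n ] f i * c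
*-distribʳ-∑ zero    f c = ℚ.*-zeroˡ c
*-distribʳ-∑ (suc n) f c = trans (ℚ.*-distribʳ-+ c (∑ n f) (f n)) (cong (_+ f n * c) (*-distribʳ-∑ n f c))

∑-comm : ∀ m n (f : ℕ → ℕ → ℚ) → ∑[ i < m ] ∑[ j < n ] f i j ≡ ∑[ j < n ] ∑[ i < m ] f i j
∑-comm zero    n f = sym (∑-zero n (λ _ _ → refl))
∑-comm (suc m) n f = trans (cong (_+ ∑ n (f m)) (∑-comm m n f)) (sym (∑-distrib-+ n _ (f m)))

∑-reverse : ∀ n f → ∑ n f ≡ ∑[ i < n ] f (n ∸ suc i)
∑-reverse zero    f = refl
∑-reverse (suc n) f = begin
  ∑ n f + f n                          ≡⟨ cong (_+ f n) (∑-reverse n f) ⟩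
  ∑[ i < n ] f (n ∸ suc i) + f n       ≡⟨ ℚ.+-comm _ (f n) ⟩
  f n + ∑[ i < n ] f (n ∸ suc i)       ≡⟨ ∑-head n (λ i → f (suc n ∸ suc i)) ⟨
  ∑[ i < suc n ] f (suc n ∸ suc i)     ∎
  where open ≡-Reasoning

foldr-applyUpTo : ∀ n (g : ℕ → ℕ) (f : ℕ → ℚ) → foldr _+_ 0ℚ (map f (applyUpTo g n)) ≡ ∑[ i < n ] f (g i)
foldr-applyUpTo zero    g f = refl
foldr-applyUpTo (suc n) g f = trans (cong (_+_ (f (g 0))) (foldr-applyUpTo n (g ∘ suc) f)) (sym (∑-head n (f ∘ g)))

ΣQ≡∑ : ∀ a b f → ΣQ a b f ≡ ∑[ i < suc b ∸ a ] f (a ℕ.+ i)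
ΣQ≡∑ a b f = foldr-applyUpTo (suc b ∸ a) (λ i → i) (λ i → f (a ℕ.+ i))

s₁ : ℕ → ℕ → ℚ
s₁ n m = ℤ→ℚ (S₁ n m)

s₂ : ℕ → ℕ → ℚ
s₂ n m = ℕ→ℚ (S₂ n m)

binomial : ℕ → ℕ → ℚ
binomial n k = ℕ→ℚ (n C k)

δ : ℕ → ℕ → ℚ
δ zero    zero    = 1ℚ
δ zero    (suc n) = 0ℚ
δ (suc m) zero    = 0ℚ
δ (suc m) (suc n) = δ m n

δ-refl : ∀ p → δ p p ≡ 1ℚ
δ-refl zero    = refl
δ-refl (suc p) = δ-refl p

δ-< : ∀ p n → δ (p ℕ.+ suc n) p ≡ 0ℚ
δ-< zero    n = refl
δ-< (suc p) n = δ-< p n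

-- A sequence a : ℕ → ℚ stands for the polynomial ∑ₚ a p xᵖ; x· a is its product with x.
x· : (ℕ → ℚ) → ℕ → ℚ
x· a zero    = 0ℚ
x· a (suc p) = a p

x·-cong : ∀ {a b} → (∀ q → a q ≡ b q) → ∀ p → x· a p ≡ x· b p
x·-cong a≗b zero    = refl
x·-cong a≗b (suc p) = a≗b p

x·-∑ : ∀ n (c : ℕ → ℚ) (a : ℕ → ℕ → ℚ) p →
       ∑[ i < n ] c i * x· (a i) p ≡ x· (λ q → ∑[ i < n ] c i * a i q) p
x·-∑ n c a zero    = ∑-zero n (λ i _ → ℚ.*-zeroʳ (c i))
x·-∑ n c a (suc p) = refl

x·δ : ∀ k p → x· (δ k) p ≡ δ (suc k) p
x·δ k zero    = refl
x·δ k (suc p) = refl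

S₁-vanish : ∀ {n m} → n < m → S₁ n m ≡ + 0
S₁-vanish {zero}  {suc m} _         = refl
S₁-vanish {suc n} {suc m} (s≤s n<m)
  rewrite S₁-vanish n<m | S₁-vanish (ℕ.m≤n⇒m≤1+n n<m) | ℤ.*-zeroʳ (+ n) = refl

S₂-vanish : ∀ {n m} → n < m → S₂ n m ≡ 0
S₂-vanish {zero}  {suc m} _         = refl
S₂-vanish {suc n} {suc m} (s≤s n<m)
  rewrite S₂-vanish n<m | S₂-vanish (ℕ.m≤n⇒m≤1+n n<m) | ℕ.*-zeroʳ (suc m) = refl

s₁-vanish : ∀ {n m} → n < m → s₁ n m ≡ 0ℚ
s₁-vanish n<m = cong ℤ→ℚ (S₁-vanish n<m)

s₂-vanish : ∀ {n m} → n < m → s₂ n m ≡ 0ℚ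
s₂-vanish n<m = cong ℕ→ℚ (S₂-vanish n<m)

binomial-vanish : ∀ {n k} → n < k → binomial n k ≡ 0ℚ
binomial-vanish n<k = cong ℕ→ℚ (k>n⇒nCk≡0 n<k)

s₂-suc : ∀ n m → s₂ (suc n) (suc m) ≡ s₂ n m + ℕ→ℚ (suc m) * s₂ n (suc m)
s₂-suc n m = trans (ℕ→ℚ-+ (S₂ n m) _) (cong (λ x → s₂ n m + x) (ℕ→ℚ-* (suc m) (S₂ n (suc m))))

n*s₁[n,0]≡0 : ∀ n → ℕ→ℚ n * s₁ n 0 ≡ 0ℚ
n*s₁[n,0]≡0 zero    = ℚ.*-zeroˡ (s₁ 0 0)
n*s₁[n,0]≡0 (suc n) = ℚ.*-zeroʳ (ℕ→ℚ (suc n))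

s₁-suc : ∀ n p → s₁ (suc n) p ≡ x· (s₁ n) p - ℕ→ℚ n * s₁ n p
s₁-suc n zero    = sym (trans (ℚ.+-identityˡ _) (cong -_ (n*s₁[n,0]≡0 n)))
s₁-suc n (suc p) =
  trans (ℤ→ℚ-- (S₁ n p) (+ n ℤ.* S₁ n (suc p))) (cong (λ x → s₁ n p - x) (ℤ→ℚ-* (+ n) (S₁ n (suc p))))

binomial-suc : ∀ m p → binomial (suc m) p ≡ x· (binomial m) p + binomial m p
binomial-suc m zero    = sym (ℚ.+-identityˡ 1ℚ)
binomial-suc m (suc p) = trans (cong ℕ→ℚ (sym (nCk+nC[k+1]≡[n+1]C[k+1] m p))) (ℕ→ℚ-+ (m C p) (m C suc p))

s₁[0,p]≡δ : ∀ p → s₁ 0 p ≡ δ 0 p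
s₁[0,p]≡δ zero    = refl
s₁[0,p]≡δ (suc p) = refl

binomial[0,p]≡δ : ∀ p → binomial 0 p ≡ δ 0 p
binomial[0,p]≡δ zero    = refl
binomial[0,p]≡δ (suc p) = refl

stirling-inversion : ∀ k {N} p → k < N → ∑[ i < N ] s₂ k i * s₁ i p ≡ δ k p
stirling-inversion zero {suc N} p _ = begin
  ∑[ i < suc N ] s₂ 0 i * s₁ i p                        ≡⟨ ∑-head N (λ i → s₂ 0 i * s₁ i p) ⟩
  1ℚ * s₁ 0 p + ∑[ i < N ] s₂ 0 (suc i) * s₁ (suc i) p  ≡⟨ cong₂ _+_ (ℚ.*-identityˡ (s₁ 0 p))
                                                                     (∑-zero N (λ i _ → ℚ.*-zeroˡ (s₁ (suc i) p))) ⟩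
  s₁ 0 p + 0ℚ                                           ≡⟨ ℚ.+-identityʳ (s₁ 0 p) ⟩
  s₁ 0 p                                                ≡⟨ s₁[0,p]≡δ p ⟩
  δ 0 p                                                 ∎
  where open ≡-Reasoning
stirling-inversion (suc k) {suc N} p (s≤s k<N) = begin
  ∑[ i < suc N ] s₂ (suc k) i * s₁ i p
    ≡⟨ ∑-head N (λ i → s₂ (suc k) i * s₁ i p) ⟩
  0ℚ * s₁ 0 p + ∑[ i < N ] s₂ (suc k) (suc i) * s₁ (suc i) p
    ≡⟨ trans (cong (_+ ∑[ i < N ] s₂ (suc k) (suc i) * s₁ (suc i) p) (ℚ.*-zeroˡ (s₁ 0 p))) (ℚ.+-identityˡ _) ⟩
  ∑[ i < N ] s₂ (suc k) (suc i) * s₁ (suc i) p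
    ≡⟨ ∑-cong N (λ i _ → expand-s₂ i) ⟩
  ∑[ i < N ] (s₂ k i * s₁ (suc i) p + G (suc i))
    ≡⟨ ∑-distrib-+ N _ (G ∘ suc) ⟩
  ∑[ i < N ] s₂ k i * s₁ (suc i) p + ∑[ i < N ] G (suc i)
    ≡⟨ cong (_+_ (∑[ i < N ] s₂ k i * s₁ (suc i) p)) (∑-rotate N G G0≡0 GN≡0) ⟩
  ∑[ i < N ] s₂ k i * s₁ (suc i) p + ∑ N G
    ≡⟨ sym (∑-distrib-+ N _ G) ⟩
  ∑[ i < N ] (s₂ k i * s₁ (suc i) p + G i)
    ≡⟨ ∑-cong N (λ i _ → fold-s₁ i) ⟩
  ∑[ i < N ] s₂ k i * x· (s₁ i) p
    ≡⟨ x·-∑ N (s₂ k) s₁ p ⟩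
  x· (λ q → ∑[ i < N ] s₂ k i * s₁ i q) p
    ≡⟨ x·-cong (λ q → stirling-inversion k q k<N) p ⟩
  x· (δ k) p
    ≡⟨ x·δ k p ⟩
  δ (suc k) p ∎
  where
  open ≡-Reasoning
  G : ℕ → ℚ
  G i = ℕ→ℚ i * s₂ k i * s₁ i p
  G0≡0 : G 0 ≡ 0ℚ
  G0≡0 = trans (cong (_* s₁ 0 p) (ℚ.*-zeroˡ (s₂ k 0))) (ℚ.*-zeroˡ (s₁ 0 p))
  GN≡0 : G N ≡ 0ℚ
  GN≡0 = trans (cong (λ x → ℕ→ℚ N * x * s₁ N p) (s₂-vanish k<N))
               (trans (cong (_* s₁ N p) (ℚ.*-zeroʳ (ℕ→ℚ N))) (ℚ.*-zeroˡ (s₁ N p)))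
  distrib : ∀ a n b c → (a + n * b) * c ≡ a * c + n * b * c
  distrib = solve-∀ ℚ-ring
  cancel : ∀ a x n c → a * (x - n * c) + n * a * c ≡ a * x
  cancel = solve-∀ ℚ-ring
  expand-s₂ : ∀ i → s₂ (suc k) (suc i) * s₁ (suc i) p ≡ s₂ k i * s₁ (suc i) p + G (suc i)
  expand-s₂ i = trans (cong (_* s₁ (suc i) p) (s₂-suc k i)) (distrib (s₂ k i) (ℕ→ℚ (suc i)) (s₂ k (suc i)) (s₁ (suc i) p))
  fold-s₁ : ∀ i → s₂ k i * s₁ (suc i) p + G i ≡ s₂ k i * x· (s₁ i) p
  fold-s₁ i = trans (cong (λ x → s₂ k i * x + G i) (s₁-suc i p)) (cancel (s₂ k i) (x· (s₁ i) p) (ℕ→ℚ i) (s₁ i p))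

-- Coefficients of the falling factorial (x + 1)(x)⋯(x + 2 − n) = ∑ₘ s₁(n,m) (x + 1)ᵐ.
s₁[x+1] : ℕ → ℕ → ℚ
s₁[x+1] n p = ∑[ m < suc n ] s₁ n m * binomial m p

s₁[x+1]-suc : ∀ n p → s₁[x+1] (suc n) p ≡ x· (s₁[x+1] n) p + s₁[x+1] n p - ℕ→ℚ n * s₁[x+1] n p
s₁[x+1]-suc n p = begin
  ∑[ m < suc (suc n) ] s₁ (suc n) m * binomial m p
    ≡⟨ ∑-head (suc n) (λ m → s₁ (suc n) m * binomial m p) ⟩
  0ℚ * binomial 0 p + ∑[ m < suc n ] s₁ (suc n) (suc m) * binomial (suc m) p
    ≡⟨ trans (cong (_+ ∑[ m < suc n ] s₁ (suc n) (suc m) * binomial (suc m) p) (ℚ.*-zeroˡ (binomial 0 p)))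
             (ℚ.+-identityˡ _) ⟩
  ∑[ m < suc n ] s₁ (suc n) (suc m) * binomial (suc m) p
    ≡⟨ ∑-cong (suc n) (λ m _ → expand-s₁ m) ⟩
  ∑[ m < suc n ] (s₁ n m * binomial (suc m) p - H (suc m))
    ≡⟨ ∑-distrib-- (suc n) _ (H ∘ suc) ⟩
  ∑[ m < suc n ] s₁ n m * binomial (suc m) p - ∑[ m < suc n ] H (suc m)
    ≡⟨ cong₂ _-_ (∑-cong (suc n) (λ m _ → expand-binomial m)) H-sum ⟩
  ∑[ m < suc n ] (s₁ n m * x· (binomial m) p + s₁ n m * binomial m p) - ℕ→ℚ n * s₁[x+1] n p
    ≡⟨ cong (_- ℕ→ℚ n * s₁[x+1] n p) (∑-distrib-+ (suc n) _ _) ⟩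
  ∑[ m < suc n ] s₁ n m * x· (binomial m) p + s₁[x+1] n p - ℕ→ℚ n * s₁[x+1] n p
    ≡⟨ cong (λ x → x + s₁[x+1] n p - ℕ→ℚ n * s₁[x+1] n p) (x·-∑ (suc n) (s₁ n) binomial p) ⟩
  x· (s₁[x+1] n) p + s₁[x+1] n p - ℕ→ℚ n * s₁[x+1] n p ∎
  where
  open ≡-Reasoning
  H : ℕ → ℚ
  H m = ℕ→ℚ n * (s₁ n m * binomial m p)
  H0≡0 : H 0 ≡ 0ℚ
  H0≡0 = trans (sym (ℚ.*-assoc (ℕ→ℚ n) (s₁ n 0) (binomial 0 p)))
               (trans (cong (_* binomial 0 p) (n*s₁[n,0]≡0 n)) (ℚ.*-zeroˡ (binomial 0 p)))
  H[1+n]≡0 : H (suc n) ≡ 0ℚ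
  H[1+n]≡0 = trans (cong (λ x → ℕ→ℚ n * (x * binomial (suc n) p)) (s₁-vanish (ℕ.n<1+n n)))
               (trans (cong (ℕ→ℚ n *_) (ℚ.*-zeroˡ (binomial (suc n) p))) (ℚ.*-zeroʳ (ℕ→ℚ n)))
  H-sum : ∑[ m < suc n ] H (suc m) ≡ ℕ→ℚ n * s₁[x+1] n p
  H-sum = trans (∑-rotate (suc n) H H0≡0 H[1+n]≡0) (sym (*-distribˡ-∑ (suc n) (ℕ→ℚ n) _))
  distrib : ∀ a n b c → (a - n * b) * c ≡ a * c - n * (b * c)
  distrib = solve-∀ ℚ-ring
  expand-s₁ : ∀ m → s₁ (suc n) (suc m) * binomial (suc m) p ≡ s₁ n m * binomial (suc m) p - H (suc m)
  expand-s₁ m = trans (cong (_* binomial (suc m) p) (s₁-suc n (suc m)))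
                      (distrib (s₁ n m) (ℕ→ℚ n) (s₁ n (suc m)) (binomial (suc m) p))
  expand-binomial : ∀ m → s₁ n m * binomial (suc m) p ≡ s₁ n m * x· (binomial m) p + s₁ n m * binomial m p
  expand-binomial m = trans (cong (s₁ n m *_) (binomial-suc m p)) (ℚ.*-distribˡ-+ (s₁ n m) _ _)

s₁[x+1]-zero : ∀ p → s₁[x+1] 0 p ≡ s₁ 0 p
s₁[x+1]-zero p = begin
  0ℚ + 1ℚ * binomial 0 p   ≡⟨ ℚ.+-identityˡ _ ⟩
  1ℚ * binomial 0 p        ≡⟨ ℚ.*-identityˡ _ ⟩
  binomial 0 p             ≡⟨ binomial[0,p]≡δ p ⟩
  δ 0 p                    ≡⟨ s₁[0,p]≡δ p ⟨
  s₁ 0 p                   ∎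
  where open ≡-Reasoning

s₁[x+1]≡[1+x]s₁ : ∀ n p → s₁[x+1] (suc n) p ≡ x· (s₁ n) p + s₁ n p
s₁[x+1]≡[1+x]s₁ zero p = begin
  s₁[x+1] 1 p                                           ≡⟨ s₁[x+1]-suc 0 p ⟩
  x· (s₁[x+1] 0) p + s₁[x+1] 0 p - 0ℚ * s₁[x+1] 0 p     ≡⟨ cong₂ (λ a b → a + b - 0ℚ * b) (x·-cong s₁[x+1]-zero p) (s₁[x+1]-zero p) ⟩
  x· (s₁ 0) p + s₁ 0 p - 0ℚ * s₁ 0 p                    ≡⟨ drop-zero (x· (s₁ 0) p) (s₁ 0 p) ⟩
  x· (s₁ 0) p + s₁ 0 p                                  ∎
  where
  open ≡-Reasoning
  drop-zero : ∀ a b → a + b - 0ℚ * b ≡ a + b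
  drop-zero = solve-∀ ℚ-ring
s₁[x+1]≡[1+x]s₁ (suc n) p = begin
  s₁[x+1] (suc (suc n)) p
    ≡⟨ s₁[x+1]-suc (suc n) p ⟩
  x· (s₁[x+1] (suc n)) p + s₁[x+1] (suc n) p - ℕ→ℚ (suc n) * s₁[x+1] (suc n) p
    ≡⟨ cong₂ (λ a b → a + b - ℕ→ℚ (suc n) * b) (x·-cong (s₁[x+1]≡[1+x]s₁ n) p) (s₁[x+1]≡[1+x]s₁ n p) ⟩
  x· R p + R p - ℕ→ℚ (suc n) * R p
    ≡⟨ step p ⟩
  x· (s₁ (suc n)) p + s₁ (suc n) p ∎
  where
  open ≡-Reasoning
  R : ℕ → ℚ
  R q = x· (s₁ n) q + s₁ n q
  step : ∀ p → x· R p + R p - ℕ→ℚ (suc n) * R p ≡ x· (s₁ (suc n)) p + s₁ (suc n) p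
  step zero = begin
    0ℚ + R 0 - ℕ→ℚ (suc n) * R 0               ≡⟨ cong (λ N → 0ℚ + R 0 - N * R 0) (ℕ→ℚ-suc n) ⟩
    0ℚ + (0ℚ + b) - (1ℚ + ℕ→ℚ n) * (0ℚ + b)    ≡⟨ collapse (ℕ→ℚ n) b ⟩
    - (ℕ→ℚ n * b)                              ≡⟨ cong -_ (n*s₁[n,0]≡0 n) ⟩
    0ℚ + s₁ (suc n) 0                          ∎
    where
    b = s₁ n 0
    collapse : ∀ N b → 0ℚ + (0ℚ + b) - (1ℚ + N) * (0ℚ + b) ≡ - (N * b)
    collapse = solve-∀ ℚ-ring
  step (suc p) = begin
    R p + R (suc p) - ℕ→ℚ (suc n) * R (suc p)
      ≡⟨ cong (λ N → R p + R (suc p) - N * R (suc p)) (ℕ→ℚ-suc n) ⟩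
    (X + a) + (a + b) - (1ℚ + ℕ→ℚ n) * (a + b)
      ≡⟨ regroup X a b (ℕ→ℚ n) ⟩
    (X - ℕ→ℚ n * a) + (a - ℕ→ℚ n * b)
      ≡⟨ cong₂ _+_ (s₁-suc n p) (s₁-suc n (suc p)) ⟨
    s₁ (suc n) p + s₁ (suc n) (suc p) ∎
    where
    X = x· (s₁ n) p
    a = s₁ n p
    b = s₁ n (suc p)
    regroup : ∀ X a b N → (X + a) + (a + b) - (1ℚ + N) * (a + b) ≡ (X - N * a) + (a - N * b)
    regroup = solve-∀ ℚ-ring

-- `lastOr`, `nextB` and `weighted` are private to Defs. Each is reached by unfolding `bernoulli` and
-- abstracting, with `with`, the arguments it is applied to; it is then the solution of a pattern
-- unification problem and can be passed to a lemma about all functions with its defining equations.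
last-∷ʳ : (last : List ℚ → ℚ) → (∀ x → last (x ∷ []) ≡ x) → (∀ x y xs → last (x ∷ y ∷ xs) ≡ last (y ∷ xs)) →
          ∀ xs y {zs} → xs ∷ʳ y ≡ zs → last zs ≡ y
last-∷ʳ last last-[x] last-∷∷ []           y refl = last-[x] y
last-∷ʳ last last-[x] last-∷∷ (x ∷ [])     y refl = trans (last-∷∷ x y []) (last-[x] y)
last-∷ʳ last last-[x] last-∷∷ (x ∷ x′ ∷ xs) y refl = trans (last-∷∷ x x′ (xs ∷ʳ y)) (last-∷ʳ last last-[x] last-∷∷ (x′ ∷ xs) y refl)

bernList-∷ʳ : ∀ n → bernList (suc n) ≡ bernList n ∷ʳ bernoulli n
bernList-∷ʳ n with last-∷ʳ _ (λ _ → refl) (λ _ _ _ → refl) | bernList (suc n) in eq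
... | lastOr-∷ʳ | zs = trans (sym eq) (cong (bernList n ∷ʳ_) (sym (lastOr-∷ʳ (bernList n) _ eq)))

length-bernList : ∀ n → length (bernList n) ≡ n
length-bernList zero    = refl
length-bernList (suc n) = begin
  length (bernList (suc n))              ≡⟨ cong length (bernList-∷ʳ n) ⟩
  length (bernList n ∷ʳ bernoulli n)     ≡⟨ length-++ (bernList n) ⟩
  length (bernList n) ℕ.+ 1              ≡⟨ cong (ℕ._+ 1) (length-bernList n) ⟩
  n ℕ.+ 1                                ≡⟨ ℕ.+-comm n 1 ⟩
  suc n                                  ∎
  where open ≡-Reasoning

-- A copy of `weighted`, which cannot be named here.
binomialWeighted : ℕ → ℕ → List ℚ → ℚ
binomialWeighted n m []       = 0ℚ
binomialWeighted n m (b ∷ bs) = binomial (suc n) m * b + binomialWeighted n (suc m) bs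

binomialWeighted-unique : ∀ n (w : ℕ → List ℚ → ℚ) → (∀ m → w m [] ≡ 0ℚ) →
  (∀ m b bs → w m (b ∷ bs) ≡ binomial (suc n) m * b + w (suc m) bs) → ∀ m xs → w m xs ≡ binomialWeighted n m xs
binomialWeighted-unique n w w-[] w-∷ m []       = w-[] m
binomialWeighted-unique n w w-[] w-∷ m (b ∷ bs) =
  trans (w-∷ m b bs) (cong (_+_ (binomial (suc n) m * b)) (binomialWeighted-unique n w w-[] w-∷ (suc m) bs))

bernoulli-suc : ∀ k → bernoulli (suc k) ≡ - (1/suc (suc k) * binomialWeighted (suc k) 0 (bernList (suc k)))
bernoulli-suc k
  -- 1/suc (suc k) is abstracted first: its normal form contains the literal 0 as well.
  with 1/suc (suc k) | binomialWeighted-unique (suc k) _ (λ _ → refl) (λ _ _ _ → refl)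
     | ∷ʳ-injectiveʳ (bernList (suc k)) (bernList (suc k)) (bernList-∷ʳ (suc k))
... | q | weighted≡ | nextB≡B with 0 | bernList (suc k)
...   | z | xs = trans (sym nextB≡B) (cong (λ W → - (q * W)) (weighted≡ z xs))

binomialWeighted-∷ʳ : ∀ n m xs y → binomialWeighted n m (xs ∷ʳ y) ≡ binomialWeighted n m xs + binomial (suc n) (m ℕ.+ length xs) * y
binomialWeighted-∷ʳ n m [] y = begin
  binomial (suc n) m * y + 0ℚ             ≡⟨ ℚ.+-identityʳ _ ⟩
  binomial (suc n) m * y                  ≡⟨ cong (λ i → binomial (suc n) i * y) (ℕ.+-identityʳ m) ⟨
  binomial (suc n) (m ℕ.+ 0) * y          ≡⟨ ℚ.+-identityˡ _ ⟨
  0ℚ + binomial (suc n) (m ℕ.+ 0) * y     ∎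
  where open ≡-Reasoning
binomialWeighted-∷ʳ n m (x ∷ xs) y = begin
  c m * x + binomialWeighted n (suc m) (xs ∷ʳ y)
    ≡⟨ cong (_+_ (c m * x)) (binomialWeighted-∷ʳ n (suc m) xs y) ⟩
  c m * x + (binomialWeighted n (suc m) xs + c (suc m ℕ.+ length xs) * y)
    ≡⟨ ℚ.+-assoc (c m * x) _ _ ⟨
  binomialWeighted n m (x ∷ xs) + c (suc m ℕ.+ length xs) * y
    ≡⟨ cong (λ i → binomialWeighted n m (x ∷ xs) + c i * y) (ℕ.+-suc m (length xs)) ⟨
  binomialWeighted n m (x ∷ xs) + c (m ℕ.+ length (x ∷ xs)) * y ∎
  where
  open ≡-Reasoning
  c = binomial (suc n)

binomialWeighted-bernList : ∀ n N → binomialWeighted n 0 (bernList N) ≡ ∑[ s < N ] binomial (suc n) s * bernoulli s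
binomialWeighted-bernList n zero    = refl
binomialWeighted-bernList n (suc N) = begin
  binomialWeighted n 0 (bernList (suc N))
    ≡⟨ cong (binomialWeighted n 0) (bernList-∷ʳ N) ⟩
  binomialWeighted n 0 (bernList N ∷ʳ bernoulli N)
    ≡⟨ binomialWeighted-∷ʳ n 0 (bernList N) (bernoulli N) ⟩
  binomialWeighted n 0 (bernList N) + binomial (suc n) (length (bernList N)) * bernoulli N
    ≡⟨ cong₂ (λ a i → a + binomial (suc n) i * bernoulli N) (binomialWeighted-bernList n N) (length-bernList N) ⟩
  ∑[ s < suc N ] binomial (suc n) s * bernoulli s ∎
  where open ≡-Reasoning

bernoulli-recurrence : ∀ n → ∑[ s < suc n ] binomial (suc n) s * bernoulli s ≡ δ n 0
bernoulli-recurrence zero    = refl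
bernoulli-recurrence (suc k) = begin
  S + binomial (suc (suc k)) (suc k) * bernoulli (suc k)
    ≡⟨ cong₂ (λ c B → S + c * B) (cong ℕ→ℚ ([1+n]Cn≡1+n (suc k)))
             (trans (bernoulli-suc k) (cong (λ W → - (1/suc (suc k) * W)) (binomialWeighted-bernList (suc k) (suc k)))) ⟩
  S + ℕ→ℚ (suc (suc k)) * - (1/suc (suc k) * S)
    ≡⟨ regroup S (ℕ→ℚ (suc (suc k))) (1/suc (suc k)) ⟩
  S - ℕ→ℚ (suc (suc k)) * 1/suc (suc k) * S
    ≡⟨ cong (λ x → S - x * S) (ℕ→ℚ-suc*1/suc (suc k)) ⟩
  S - 1ℚ * S
    ≡⟨ cancel S ⟩
  0ℚ ∎
  where
  open ≡-Reasoning
  S = ∑[ s < suc k ] binomial (suc (suc k)) s * bernoulli s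
  regroup : ∀ S N q → S + N * - (q * S) ≡ S - N * q * S
  regroup = solve-∀ ℚ-ring
  cancel : ∀ S → S - 1ℚ * S ≡ 0ℚ
  cancel = solve-∀ ℚ-ring

BinomialSystem : ℕ → (ℕ → ℚ) → Set
BinomialSystem k d = ∀ p → p ≤ k → ∑[ m < suc (suc k) ] d m * binomial m p ≡ d p + δ k p

stirlingCoeff : ℕ → ℕ → ℚ
stirlingCoeff k m = ∑[ i < suc k ] 1/suc i * (s₁ (suc i) m * s₂ k i)

∑-s₁-binomial : ∀ {i N} p → suc i < N → ∑[ m < N ] s₁ (suc i) m * binomial m p ≡ s₁ (suc i) p + ℕ→ℚ (suc i) * s₁ i p
∑-s₁-binomial {i} {N} p i+1<N = begin
  ∑[ m < N ] s₁ (suc i) m * binomial m p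
    ≡⟨ ∑-tail-zero (λ m → s₁ (suc i) m * binomial m p) i+1<N beyond-i+1 ⟩
  s₁[x+1] (suc i) p
    ≡⟨ s₁[x+1]≡[1+x]s₁ i p ⟩
  x· (s₁ i) p + s₁ i p
    ≡⟨ regroup (x· (s₁ i) p) (ℕ→ℚ i) (s₁ i p) ⟩
  (x· (s₁ i) p - ℕ→ℚ i * s₁ i p) + (1ℚ + ℕ→ℚ i) * s₁ i p
    ≡⟨ cong₂ (λ a N → a + N * s₁ i p) (s₁-suc i p) (ℕ→ℚ-suc i) ⟨
  s₁ (suc i) p + ℕ→ℚ (suc i) * s₁ i p ∎
  where
  open ≡-Reasoning
  beyond-i+1 : ∀ m → suc (suc i) ≤ m → m < N → s₁ (suc i) m * binomial m p ≡ 0ℚ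
  beyond-i+1 m i+1<m _ = trans (cong (_* binomial m p) (s₁-vanish i+1<m)) (ℚ.*-zeroˡ (binomial m p))
  regroup : ∀ X N a → X + a ≡ (X - N * a) + (1ℚ + N) * a
  regroup = solve-∀ ℚ-ring

stirlingCoeff-solves : ∀ k → BinomialSystem k (stirlingCoeff k)
stirlingCoeff-solves k p _ = begin
  ∑[ m < suc (suc k) ] stirlingCoeff k m * binomial m p
    ≡⟨ ∑-cong (suc (suc k)) (λ m _ → *-distribʳ-∑ (suc k) _ (binomial m p)) ⟩
  ∑[ m < suc (suc k) ] ∑[ i < suc k ] 1/suc i * (s₁ (suc i) m * s₂ k i) * binomial m p
    ≡⟨ ∑-comm (suc (suc k)) (suc k) (λ m i → 1/suc i * (s₁ (suc i) m * s₂ k i) * binomial m p) ⟩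
  ∑[ i < suc k ] ∑[ m < suc (suc k) ] 1/suc i * (s₁ (suc i) m * s₂ k i) * binomial m p
    ≡⟨ ∑-cong (suc k) (λ i i<1+k → inner i (s≤s i<1+k)) ⟩
  ∑[ i < suc k ] (1/suc i * (s₁ (suc i) p * s₂ k i) + s₂ k i * s₁ i p)
    ≡⟨ ∑-distrib-+ (suc k) _ _ ⟩
  stirlingCoeff k p + ∑[ i < suc k ] s₂ k i * s₁ i p
    ≡⟨ cong (_+_ (stirlingCoeff k p)) (stirling-inversion k p (ℕ.n<1+n k)) ⟩
  stirlingCoeff k p + δ k p ∎
  where
  open ≡-Reasoning
  inner : ∀ i → suc i < suc (suc k) →
          ∑[ m < suc (suc k) ] 1/suc i * (s₁ (suc i) m * s₂ k i) * binomial m p ≡ 1/suc i * (s₁ (suc i) p * s₂ k i) + s₂ k i * s₁ i p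
  inner i i+1<k+2 = begin
    ∑[ m < suc (suc k) ] 1/suc i * (s₁ (suc i) m * s₂ k i) * binomial m p
      ≡⟨ ∑-cong (suc (suc k)) (λ m _ → pull-out (1/suc i) (s₁ (suc i) m) (s₂ k i) (binomial m p)) ⟩
    ∑[ m < suc (suc k) ] 1/suc i * s₂ k i * (s₁ (suc i) m * binomial m p)
      ≡⟨ *-distribˡ-∑ (suc (suc k)) (1/suc i * s₂ k i) _ ⟨
    1/suc i * s₂ k i * (∑[ m < suc (suc k) ] s₁ (suc i) m * binomial m p)
      ≡⟨ cong (1/suc i * s₂ k i *_) (∑-s₁-binomial p i+1<k+2) ⟩
    1/suc i * s₂ k i * (s₁ (suc i) p + ℕ→ℚ (suc i) * s₁ i p)
      ≡⟨ expand (1/suc i) (s₂ k i) (s₁ (suc i) p) (ℕ→ℚ (suc i)) (s₁ i p) ⟩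
    1/suc i * (s₁ (suc i) p * s₂ k i) + ℕ→ℚ (suc i) * 1/suc i * (s₂ k i * s₁ i p)
      ≡⟨ cong (λ c → 1/suc i * (s₁ (suc i) p * s₂ k i) + c * (s₂ k i * s₁ i p)) (ℕ→ℚ-suc*1/suc i) ⟩
    1/suc i * (s₁ (suc i) p * s₂ k i) + 1ℚ * (s₂ k i * s₁ i p)
      ≡⟨ cong (_+_ (1/suc i * (s₁ (suc i) p * s₂ k i))) (ℚ.*-identityˡ _) ⟩
    1/suc i * (s₁ (suc i) p * s₂ k i) + s₂ k i * s₁ i p ∎
    where
    pull-out : ∀ v a s c → v * (a * s) * c ≡ v * s * (a * c)
    pull-out = solve-∀ ℚ-ring
    expand : ∀ v s a N b → v * s * (a + N * b) ≡ v * (a * s) + N * v * (s * b)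
    expand = solve-∀ ℚ-ring

bernoulliCoeff : ℕ → ℕ → ℚ
bernoulliCoeff k m = binomial (suc k) m * bernoulli (suc k ∸ m) * 1/suc k

∑-binomial-bernoulli : ∀ n → ∑[ t < suc (suc n) ] binomial (suc n) t * bernoulli (suc n ∸ t) ≡ δ n 0 + bernoulli (suc n)
∑-binomial-bernoulli n = begin
  ∑[ t < suc (suc n) ] binomial (suc n) t * bernoulli (suc n ∸ t)
    ≡⟨ ∑-reverse (suc (suc n)) _ ⟩
  ∑[ r < suc (suc n) ] binomial (suc n) (suc n ∸ r) * bernoulli (suc n ∸ (suc n ∸ r))
    ≡⟨ ∑-cong (suc (suc n)) (λ r r<n+2 → reflect (ℕ.≤-pred r<n+2)) ⟩
  ∑[ r < suc n ] binomial (suc n) r * bernoulli r + binomial (suc n) (suc n) * bernoulli (suc n)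
    ≡⟨ cong₂ (λ S c → S + ℕ→ℚ c * bernoulli (suc n)) (bernoulli-recurrence n) (nCn≡1 (suc n)) ⟩
  δ n 0 + 1ℚ * bernoulli (suc n)
    ≡⟨ cong (_+_ (δ n 0)) (ℚ.*-identityˡ (bernoulli (suc n))) ⟩
  δ n 0 + bernoulli (suc n) ∎
  where
  open ≡-Reasoning
  reflect : ∀ {r} → r ≤ suc n → binomial (suc n) (suc n ∸ r) * bernoulli (suc n ∸ (suc n ∸ r)) ≡ binomial (suc n) r * bernoulli r
  reflect {r} r≤n+1 = cong₂ (λ c s → ℕ→ℚ c * bernoulli s)
    (trans (nCk≡nC[n∸k] (ℕ.m∸n≤m (suc n) r)) (cong (suc n C_) (ℕ.m∸[m∸n]≡n r≤n+1))) (ℕ.m∸[m∸n]≡n r≤n+1)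

binomial-trinomial : ∀ p n t → t ≤ suc n → binomial (suc (p ℕ.+ n)) (p ℕ.+ t) * binomial (p ℕ.+ t) p ≡ binomial (suc (p ℕ.+ n)) p * binomial (suc n) t
binomial-trinomial p n t t≤n+1 = begin
  ℕ→ℚ (K C (p ℕ.+ t)) * ℕ→ℚ ((p ℕ.+ t) C p)    ≡⟨ ℕ→ℚ-* (K C (p ℕ.+ t)) ((p ℕ.+ t) C p) ⟨
  ℕ→ℚ ((K C (p ℕ.+ t)) ℕ.* ((p ℕ.+ t) C p))    ≡⟨ cong ℕ→ℚ revision ⟩
  ℕ→ℚ ((K C p) ℕ.* (suc n C t))                ≡⟨ ℕ→ℚ-* (K C p) (suc n C t) ⟩
  ℕ→ℚ (K C p) * ℕ→ℚ (suc n C t)                ∎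
  where
  open ≡-Reasoning
  K = suc (p ℕ.+ n)
  r = suc n ∸ t
  t+r≡1+n : t ℕ.+ r ≡ suc n
  t+r≡1+n = ℕ.m+[n∸m]≡n t≤n+1
  p+t+r≡K : p ℕ.+ t ℕ.+ r ≡ K
  p+t+r≡K = trans (ℕ.+-assoc p t r) (trans (cong (p ℕ.+_) t+r≡1+n) (ℕ.+-suc p n))
  revision : (K C (p ℕ.+ t)) ℕ.* ((p ℕ.+ t) C p) ≡ (K C p) ℕ.* (suc n C t)
  revision = subst₂ (λ A B → (A C (p ℕ.+ t)) ℕ.* ((p ℕ.+ t) C p) ≡ (A C p) ℕ.* (B C t))
                    p+t+r≡K t+r≡1+n (C-trinomial-revision p t r)

binomial-δ : ∀ p n → 1/suc (p ℕ.+ n) * (binomial (suc (p ℕ.+ n)) p * δ n 0) ≡ δ (p ℕ.+ n) p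
binomial-δ p zero rewrite ℕ.+-identityʳ p = begin
  1/suc p * (binomial (suc p) p * 1ℚ)    ≡⟨ cong (1/suc p *_) (ℚ.*-identityʳ (binomial (suc p) p)) ⟩
  1/suc p * ℕ→ℚ (suc p C p)              ≡⟨ cong (λ c → 1/suc p * ℕ→ℚ c) ([1+n]Cn≡1+n p) ⟩
  1/suc p * ℕ→ℚ (suc p)                  ≡⟨ ℚ.*-comm (1/suc p) (ℕ→ℚ (suc p)) ⟩
  ℕ→ℚ (suc p) * 1/suc p                  ≡⟨ ℕ→ℚ-suc*1/suc p ⟩
  1ℚ                                     ≡⟨ δ-refl p ⟨
  δ p p                                  ∎
  where open ≡-Reasoning
binomial-δ p (suc n) = begin
  1/suc (p ℕ.+ suc n) * (binomial (suc (p ℕ.+ suc n)) p * 0ℚ)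
    ≡⟨ cong (1/suc (p ℕ.+ suc n) *_) (ℚ.*-zeroʳ (binomial (suc (p ℕ.+ suc n)) p)) ⟩
  1/suc (p ℕ.+ suc n) * 0ℚ
    ≡⟨ ℚ.*-zeroʳ (1/suc (p ℕ.+ suc n)) ⟩
  0ℚ
    ≡⟨ δ-< p n ⟨
  δ (p ℕ.+ suc n) p ∎
  where open ≡-Reasoning

bernoulliCoeff-solves-row : ∀ p n → let k = p ℕ.+ n in
  ∑[ m < suc (suc k) ] bernoulliCoeff k m * binomial m p ≡ bernoulliCoeff k p + δ k p
bernoulliCoeff-solves-row p n = begin
  ∑[ m < suc (suc k) ] bernoulliCoeff k m * binomial m p
    ≡⟨ ∑-cong (suc (suc k)) (λ m _ → regroup (binomial (suc k) m) (bernoulli (suc k ∸ m)) (1/suc k) (binomial m p)) ⟩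
  ∑[ m < suc (suc k) ] 1/suc k * T m
    ≡⟨ *-distribˡ-∑ (suc (suc k)) (1/suc k) T ⟨
  1/suc k * ∑ (suc (suc k)) T
    ≡⟨ cong (λ N → 1/suc k * ∑ N T) (sym (trans (ℕ.+-suc p (suc n)) (cong suc (ℕ.+-suc p n)))) ⟩
  1/suc k * ∑ (p ℕ.+ suc (suc n)) T
    ≡⟨ cong (1/suc k *_) (∑-head-zero p (suc (suc n)) T below-p) ⟩
  1/suc k * (∑[ t < suc (suc n) ] T (p ℕ.+ t))
    ≡⟨ cong (1/suc k *_) (∑-cong (suc (suc n)) (λ t t<n+2 → factor t (ℕ.≤-pred t<n+2))) ⟩
  1/suc k * (∑[ t < suc (suc n) ] binomial (suc k) p * (binomial (suc n) t * bernoulli (suc n ∸ t)))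
    ≡⟨ cong (1/suc k *_) (*-distribˡ-∑ (suc (suc n)) (binomial (suc k) p) _) ⟨
  1/suc k * (binomial (suc k) p * (∑[ t < suc (suc n) ] binomial (suc n) t * bernoulli (suc n ∸ t)))
    ≡⟨ cong (λ S → 1/suc k * (binomial (suc k) p * S)) (∑-binomial-bernoulli n) ⟩
  1/suc k * (binomial (suc k) p * (δ n 0 + bernoulli (suc n)))
    ≡⟨ expand (1/suc k) (binomial (suc k) p) (δ n 0) (bernoulli (suc n)) ⟩
  binomial (suc k) p * bernoulli (suc n) * 1/suc k + 1/suc k * (binomial (suc k) p * δ n 0)
    ≡⟨ cong₂ (λ s x → binomial (suc k) p * bernoulli s * 1/suc k + x) (sym 1+k∸p≡1+n) (binomial-δ p n) ⟩
  bernoulliCoeff k p + δ k p ∎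
  where
  open ≡-Reasoning
  k = p ℕ.+ n
  T : ℕ → ℚ
  T m = binomial (suc k) m * binomial m p * bernoulli (suc k ∸ m)
  regroup : ∀ a b v c → a * b * v * c ≡ v * (a * c * b)
  regroup = solve-∀ ℚ-ring
  expand : ∀ v a d b → v * (a * (d + b)) ≡ a * b * v + v * (a * d)
  expand = solve-∀ ℚ-ring
  1+k∸p≡1+n : suc k ∸ p ≡ suc n
  1+k∸p≡1+n = trans (cong (_∸ p) (sym (ℕ.+-suc p n))) (ℕ.m+n∸m≡n p (suc n))
  below-p : ∀ m → m < p → T m ≡ 0ℚ
  below-p m m<p = begin
    binomial (suc k) m * binomial m p * bernoulli (suc k ∸ m)   ≡⟨ cong (λ c → binomial (suc k) m * c * bernoulli (suc k ∸ m)) (binomial-vanish m<p) ⟩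
    binomial (suc k) m * 0ℚ * bernoulli (suc k ∸ m)            ≡⟨ cong (_* bernoulli (suc k ∸ m)) (ℚ.*-zeroʳ (binomial (suc k) m)) ⟩
    0ℚ * bernoulli (suc k ∸ m)                                 ≡⟨ ℚ.*-zeroˡ (bernoulli (suc k ∸ m)) ⟩
    0ℚ                                                         ∎
  factor : ∀ t → t ≤ suc n → T (p ℕ.+ t) ≡ binomial (suc k) p * (binomial (suc n) t * bernoulli (suc n ∸ t))
  factor t t≤n+1 = begin
    binomial (suc k) (p ℕ.+ t) * binomial (p ℕ.+ t) p * bernoulli (suc k ∸ (p ℕ.+ t))
      ≡⟨ cong₂ (λ c s → c * bernoulli s) (binomial-trinomial p n t t≤n+1) 1+k∸[p+t]≡1+n∸t ⟩
    binomial (suc k) p * binomial (suc n) t * bernoulli (suc n ∸ t)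
      ≡⟨ ℚ.*-assoc (binomial (suc k) p) _ _ ⟩
    binomial (suc k) p * (binomial (suc n) t * bernoulli (suc n ∸ t)) ∎
    where
    1+k∸[p+t]≡1+n∸t : suc k ∸ (p ℕ.+ t) ≡ suc n ∸ t
    1+k∸[p+t]≡1+n∸t = trans (cong (_∸ (p ℕ.+ t)) (sym (ℕ.+-suc p n))) (ℕ.[m+n]∸[m+o]≡n∸o p (suc n) t)

bernoulliCoeff-solves : ∀ k → BinomialSystem k (bernoulliCoeff k)
bernoulliCoeff-solves k p p≤k = subst (λ k → ∑[ m < suc (suc k) ] bernoulliCoeff k m * binomial m p ≡ bernoulliCoeff k p + δ k p)
                                      (ℕ.m+[n∸m]≡n p≤k) (bernoulliCoeff-solves-row p (k ∸ p))

module HomogeneousBinomialSystem {K} {d : ℕ → ℚ}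
    (solves : ∀ p → p ≤ K → ∑[ m < suc (suc K) ] d m * binomial m p ≡ d p) where

  -- Once the unknowns beyond d (suc p) vanish, row p reads d p + (1 + p) d (suc p) = d p.
  vanish-step : ∀ p → p ≤ K → (∀ q → p < q → q ≤ K → d (suc q) ≡ 0ℚ) → d (suc p) ≡ 0ℚ
  vanish-step p p≤K vanish-above = begin
    d (suc p)                                ≡⟨ ℚ.*-identityʳ (d (suc p)) ⟨
    d (suc p) * 1ℚ                           ≡⟨ cong (d (suc p) *_) (ℕ→ℚ-suc*1/suc p) ⟨
    d (suc p) * (ℕ→ℚ (suc p) * 1/suc p)      ≡⟨ ℚ.*-assoc (d (suc p)) (ℕ→ℚ (suc p)) (1/suc p) ⟨
    d (suc p) * ℕ→ℚ (suc p) * 1/suc p        ≡⟨ cong (_* 1/suc p) top≡0 ⟩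
    0ℚ * 1/suc p                             ≡⟨ ℚ.*-zeroˡ (1/suc p) ⟩
    0ℚ                                       ∎
    where
    open ≡-Reasoning
    f : ℕ → ℚ
    f m = d m * binomial m p
    below-p : ∀ m → m < p → f m ≡ 0ℚ
    below-p m m<p = trans (cong (d m *_) (binomial-vanish m<p)) (ℚ.*-zeroʳ (d m))
    beyond-p+1 : ∀ m → suc (suc p) ≤ m → m < suc (suc K) → f m ≡ 0ℚ
    beyond-p+1 (suc q) (s≤s p<q) (s≤s (s≤s q≤K)) =
      trans (cong (_* binomial (suc q) p) (vanish-above q p<q q≤K)) (ℚ.*-zeroˡ (binomial (suc q) p))
    row-p : 0ℚ + d p * 1ℚ + d (suc p) * ℕ→ℚ (suc p) ≡ d p
    row-p = begin
      0ℚ + d p * 1ℚ + d (suc p) * ℕ→ℚ (suc p)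
        ≡⟨ cong₂ (λ S c → S + d p * ℕ→ℚ c + d (suc p) * ℕ→ℚ (suc p)) (∑-zero p below-p) (nCn≡1 p) ⟨
      ∑ p f + d p * binomial p p + d (suc p) * ℕ→ℚ (suc p)
        ≡⟨ cong (λ c → ∑ p f + d p * binomial p p + d (suc p) * ℕ→ℚ c) ([1+n]Cn≡1+n p) ⟨
      ∑ (suc (suc p)) f
        ≡⟨ ∑-tail-zero f (s≤s (s≤s p≤K)) beyond-p+1 ⟨
      ∑ (suc (suc K)) f
        ≡⟨ solves p p≤K ⟩
      d p ∎
    isolate : ∀ a x → x ≡ 0ℚ + a * 1ℚ + x - a
    isolate = solve-∀ ℚ-ring
    top≡0 : d (suc p) * ℕ→ℚ (suc p) ≡ 0ℚ
    top≡0 = trans (isolate (d p) _) (trans (cong (_- d p) row-p) (ℚ.+-inverseʳ (d p)))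

  vanish : ∀ t p → p ≤ K → K ≤ p ℕ.+ t → d (suc p) ≡ 0ℚ
  vanish zero    p p≤K K≤p+0   = vanish-step p p≤K λ q p<q q≤K →
    ⊥-elim (ℕ.<-irrefl refl (ℕ.<-≤-trans p<q (ℕ.≤-trans q≤K (subst (K ≤_) (ℕ.+-identityʳ p) K≤p+0))))
  vanish (suc t) p p≤K K≤p+1+t = vanish-step p p≤K λ q p<q q≤K →
    vanish t q q≤K (ℕ.≤-trans K≤p+1+t (subst (_≤ q ℕ.+ t) (sym (ℕ.+-suc p t)) (ℕ.+-monoˡ-≤ t p<q)))

  homogeneous-vanish : ∀ p → p ≤ K → d (suc p) ≡ 0ℚ
  homogeneous-vanish p p≤K = vanish K p p≤K (ℕ.m≤n+m K p)

binomialSystem-unique : ∀ {k d e} → BinomialSystem k d → BinomialSystem k e → ∀ p → p ≤ k → d (suc p) ≡ e (suc p)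
binomialSystem-unique {k} {d} {e} d-solves e-solves p p≤k = begin
  d (suc p)                               ≡⟨ add-back (d (suc p)) (e (suc p)) ⟩
  d (suc p) - e (suc p) + e (suc p)       ≡⟨ cong (_+ e (suc p)) (HomogeneousBinomialSystem.homogeneous-vanish difference-solves p p≤k) ⟩
  0ℚ + e (suc p)                          ≡⟨ ℚ.+-identityˡ (e (suc p)) ⟩
  e (suc p)                               ∎
  where
  open ≡-Reasoning
  add-back : ∀ a b → a ≡ a - b + b
  add-back = solve-∀ ℚ-ring
  difference-solves : ∀ q → q ≤ k → ∑[ m < suc (suc k) ] (d m - e m) * binomial m q ≡ d q - e q
  difference-solves q q≤k = begin
    ∑[ m < suc (suc k) ] (d m - e m) * binomial m q
      ≡⟨ ∑-cong (suc (suc k)) (λ m _ → distrib (d m) (e m) (binomial m q)) ⟩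
    ∑[ m < suc (suc k) ] (d m * binomial m q - e m * binomial m q)
      ≡⟨ ∑-distrib-- (suc (suc k)) _ _ ⟩
    ∑[ m < suc (suc k) ] d m * binomial m q - ∑[ m < suc (suc k) ] e m * binomial m q
      ≡⟨ cong₂ _-_ (d-solves q q≤k) (e-solves q q≤k) ⟩
    (d q + δ k q) - (e q + δ k q)
      ≡⟨ cancel (d q) (e q) (δ k q) ⟩
    d q - e q ∎
    where
    distrib : ∀ a b c → (a - b) * c ≡ a * c - b * c
    distrib = solve-∀ ℚ-ring
    cancel : ∀ a b c → (a + c) - (b + c) ≡ a - b
    cancel = solve-∀ ℚ-ring

stirlingCoeff≡ΣQ : ∀ {j k} → j ≤ k → stirlingCoeff k (suc j) ≡ ΣQ j k (λ i → 1/suc i * (s₁ (suc i) (suc j) * s₂ k i))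
stirlingCoeff≡ΣQ {j} {k} j≤k = begin
  ∑ (suc k) F                         ≡⟨ cong (λ n → ∑ n F) (ℕ.m+[n∸m]≡n (ℕ.m≤n⇒m≤1+n j≤k)) ⟨
  ∑ (j ℕ.+ (suc k ∸ j)) F             ≡⟨ ∑-head-zero j (suc k ∸ j) F below-j ⟩
  ∑[ t < suc k ∸ j ] F (j ℕ.+ t)      ≡⟨ ΣQ≡∑ j k F ⟨
  ΣQ j k F                            ∎
  where
  open ≡-Reasoning
  F : ℕ → ℚ
  F i = 1/suc i * (s₁ (suc i) (suc j) * s₂ k i)
  below-j : ∀ i → i < j → F i ≡ 0ℚ
  below-j i i<j = begin
    1/suc i * (s₁ (suc i) (suc j) * s₂ k i)   ≡⟨ cong (λ x → 1/suc i * (x * s₂ k i)) (s₁-vanish (s≤s i<j)) ⟩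
    1/suc i * (0ℚ * s₂ k i)                   ≡⟨ cong (1/suc i *_) (ℚ.*-zeroˡ (s₂ k i)) ⟩
    1/suc i * 0ℚ                              ≡⟨ ℚ.*-zeroʳ (1/suc i) ⟩
    0ℚ                                        ∎

bernoulliCoeff-absorb : ∀ {j k} → j ≤ k → ℕ→ℚ (suc j) * bernoulliCoeff k (suc j) ≡ binomial k j * bernoulli (k ∸ j)
bernoulliCoeff-absorb {j} {k} j≤k = begin
  ℕ→ℚ (suc j) * (binomial (suc k) (suc j) * bernoulli (k ∸ j) * 1/suc k)
    ≡⟨ regroup (ℕ→ℚ (suc j)) (binomial (suc k) (suc j)) (bernoulli (k ∸ j)) (1/suc k) ⟩
  binomial (suc k) (suc j) * ℕ→ℚ (suc j) * 1/suc k * bernoulli (k ∸ j)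
    ≡⟨ cong (λ x → x * 1/suc k * bernoulli (k ∸ j)) absorption ⟩
  ℕ→ℚ (suc k) * binomial k j * 1/suc k * bernoulli (k ∸ j)
    ≡⟨ regroup′ (ℕ→ℚ (suc k)) (binomial k j) (1/suc k) (bernoulli (k ∸ j)) ⟩
  ℕ→ℚ (suc k) * 1/suc k * (binomial k j * bernoulli (k ∸ j))
    ≡⟨ cong (_* (binomial k j * bernoulli (k ∸ j))) (ℕ→ℚ-suc*1/suc k) ⟩
  1ℚ * (binomial k j * bernoulli (k ∸ j))
    ≡⟨ ℚ.*-identityˡ _ ⟩
  binomial k j * bernoulli (k ∸ j) ∎
  where
  open ≡-Reasoning
  regroup : ∀ J c B v → J * (c * B * v) ≡ c * J * v * B
  regroup = solve-∀ ℚ-ring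
  regroup′ : ∀ K c v B → K * c * v * B ≡ K * v * (c * B)
  regroup′ = solve-∀ ℚ-ring
  absorption : binomial (suc k) (suc j) * ℕ→ℚ (suc j) ≡ ℕ→ℚ (suc k) * binomial k j
  absorption = begin
    ℕ→ℚ (suc k C suc j) * ℕ→ℚ (suc j)     ≡⟨ ℕ→ℚ-* (suc k C suc j) (suc j) ⟨
    ℕ→ℚ ((suc k C suc j) ℕ.* suc j)        ≡⟨ cong ℕ→ℚ (subst (λ k → (suc k C suc j) ℕ.* suc j ≡ suc k ℕ.* (k C j))
                                                             (ℕ.m+[n∸m]≡n j≤k) (C-absorption j (k ∸ j))) ⟩
    ℕ→ℚ (suc k ℕ.* (k C j))                ≡⟨ ℕ→ℚ-* (suc k) (k C j) ⟩
    ℕ→ℚ (suc k) * ℕ→ℚ (k C j)              ∎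

mainTheorem4 : (j k : ℕ) → j ≤ k →
    ((+ (k C j)) / 1) ℚ.* bernoulli (k ℕ.∸ j)
      ≡ ((+ suc j) / 1) ℚ.* ΣQ j k (λ i → ((+ 1) / suc i) ℚ.* ((S₁ (suc i) (suc j) / 1) ℚ.* ((+ S₂ k i) / 1)))
mainTheorem4 j k j≤k = begin
  binomial k j * bernoulli (k ∸ j)                                       ≡⟨ bernoulliCoeff-absorb j≤k ⟨
  ℕ→ℚ (suc j) * bernoulliCoeff k (suc j)                                 ≡⟨ cong (ℕ→ℚ (suc j) *_) bernoulli-side≡stirling-side ⟩
  ℕ→ℚ (suc j) * stirlingCoeff k (suc j)                                  ≡⟨ cong (ℕ→ℚ (suc j) *_) (stirlingCoeff≡ΣQ j≤k) ⟩
  ℕ→ℚ (suc j) * ΣQ j k (λ i → 1/suc i * (s₁ (suc i) (suc j) * s₂ k i))   ∎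
  where
  open ≡-Reasoning
  bernoulli-side≡stirling-side : bernoulliCoeff k (suc j) ≡ stirlingCoeff k (suc j)
  bernoulli-side≡stirling-side =
    binomialSystem-unique {d = bernoulliCoeff k} {stirlingCoeff k} (bernoulliCoeff-solves k) (stirlingCoeff-solves k) j j≤k
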